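{- Let $G$ be a device graph and let $\mathcal{F}G$ be the free strict premonoidal category on $G$. Extend the device assignment of $G$ to morphisms of $\mathcal{F}G$ inductively by $\mathsf{dev}_{\mathcal{F}G}(1_A)=\varnothing$, $\mathsf{dev}_{\mathcal{F}G}(X\triangleright f'\triangleleft Y)=\mathsf{dev}_G(f')$, and $\mathsf{dev}_{\mathcal{F}G}(g ; h)=\mathsf{dev}_{\mathcal{F}G}(g)\cup\mathsf{dev}_{\mathcal{F}G}(h)$. Let $f,g$ be morphisms of $\mathcal{F}G$ with $\mathsf{dev}_{\mathcal{F}G}(f)\cap\mathsf{dev}_{\mathcal{F}G}(g)=\varnothing$. Then $f \parallel g$ and $g\parallel f$.
   Context: Composition is written diagrammatically: $u ; v$ means first $u$ then $v$. A monoidal graph $M$ consists of a set of objects $V_M$, a set of arrows $E_M$, and source and target functions $\delta_0,\delta_1:E_M\to V_M^*$ into the set of finite lists of objects. A device graph $G$ consists of a monoidal graph (with objects $V_G$, arrows $E_G$), a set of devices, and a function $\mathsf{dev}_G$ assigning to each arrow a subset of the devices; arrows $f,g$ are orthogonal if $\mathsf{dev}_G(f)\cap\mathsf{dev}_G(g)=\varnothing$. A strict premonoidal category is a category $\mathbb{C}$ whose objects form a monoid (operation $\otimes$, unit $I$, strictly associative and unital), together with functors $A\ltimes - $ and $-\rtimes A$ for each object $A$, acting on objects by $A\ltimes B = A\otimes B = A\rtimes B$, such that $(A\ltimes f)\rtimes B = A\ltimes(f\rtimes B)$, $I\ltimes f = f = f\rtimes I$, $(A\otimes B)\ltimes f =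 A\ltimes(B\ltimes f)$ and $f\rtimes(A\otimes B)=(f\rtimes A)\rtimes B$. For $f:A\to B$ and $g:A'\to B'$, write $f\parallel g$ if $(f\rtimes A') ; (B\ltimes g) = (A\ltimes g) ; (f\rtimes B')$. The free strict premonoidal category $\mathcal{F}G$ on a device graph $G$ has objects the lists $V_G^*$ (with $\otimes$ = concatenation, $I$ = empty list); morphisms are generated by identities $1_X$, whiskered generators $X\triangleright g\triangleleft Y : X\otimes W\otimes Y\to X\otimes Z\otimes Y$ for $X,Y\in V_G^*$ and $g:W\to Z$ in $E_G$, and composition $;$, modulo the least congruence imposing associativity and unit laws of composition together with, for every pair of orthogonal arrows $f:U\to V$, $g:U'\to V'$ of $G$ and all $X,Y,Z\in V_G^*$, the equation $(X\triangleright f\triangleleft Y\otimes U'\otimes Z) ; (X\otimes V\otimes Y\triangleright g\triangleleft Z) = (X\otimes U\otimes Y\triangleright g\triangleleft Z) ; (X\triangleright f\triangleleft Y\otimes V'\otimes Z)$. Whiskerings are given on morphisms by $X\ltimes 1_Y = 1_{X\otimes Y}$, $X\ltimes(g;h)=(X\ltimes g);(X\ltimes h)$, $X\ltimes(Y\triangleright f'\triangleleft Z) = X\otimes Y\triangleright f'\triangleleft Z$, and symmetrically for $\rtimes$. -}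

module Defs where

open import Level using (0ℓ)
open import Data.List using (List; _++_)
open import Data.List.Properties using (++-assoc)
open import Data.Product using (_×_)
open import Relation.Unary using (Pred; ∅; _∪_; _∩_; Empty)
open import Relation.Binary.PropositionalEquality
  using (_≡_; refl; sym; trans; cong)

record DeviceGraph : Set₁ where
  field
    V    : Set
    E    : Set
    src  : E → List V
    tgt  : E → List V
    Dev  : Set
    dev  : E → Pred Dev 0ℓ

  Orthogonal : E → E → Set
  Orthogonal e f = Empty (dev e ∩ dev f)

module Free (G : DeviceGraph) where
  open DeviceGraph G

  infixr 9 _⨾_

  -- The whiskered generator X ▷ e ◁ Y carries
  -- equations identifying its domain/codomain with X ++ src e ++ Y, resp.
  -- X ++ tgt e ++ Y (this avoids transport along associativity of ++);
  -- the equations are made irrelevant by the congruence below.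
  data Tm : List V → List V → Set where
    idt : (A : List V) → Tm A A
    gen : ∀ {A B} (X Y : List V) (e : E) →
          A ≡ X ++ src e ++ Y → B ≡ X ++ tgt e ++ Y → Tm A B
    _⨾_ : ∀ {A B C} → Tm A B → Tm B C → Tm A C

  infix 4 _≈_

  data _≈_ : ∀ {A B} → Tm A B → Tm A B → Set where
    ≈-refl  : ∀ {A B} {f : Tm A B} → f ≈ f
    ≈-sym   : ∀ {A B} {f g : Tm A B} → f ≈ g → g ≈ f
    ≈-trans : ∀ {A B} {f g h : Tm A B} → f ≈ g → g ≈ h → f ≈ h
    ⨾-cong  : ∀ {A B C} {f f' : Tm A B} {g g' : Tm B C} →
              f ≈ f' → g ≈ g' → (f ⨾ g) ≈ (f' ⨾ g')
    assoc   : ∀ {A B C D} (f : Tm A B) (g : Tm B C) (h : Tm C D) →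
              ((f ⨾ g) ⨾ h) ≈ (f ⨾ (g ⨾ h))
    idˡ     : ∀ {A B} (f : Tm A B) → (idt A ⨾ f) ≈ f
    idʳ     : ∀ {A B} (f : Tm A B) → (f ⨾ idt B) ≈ f
    gen-irr : ∀ {A B} (X Y : List V) (e : E)
              (p p' : A ≡ X ++ src e ++ Y) (q q' : B ≡ X ++ tgt e ++ Y) →
              gen X Y e p q ≈ gen X Y e p' q'
    interchange :
      ∀ {A M M' B} (e f : E) → Orthogonal e f → (X Y Z : List V)
      (p₁ : A  ≡ X ++ src e ++ (Y ++ src f ++ Z))
      (q₁ : M  ≡ X ++ tgt e ++ (Y ++ src f ++ Z))
      (p₂ : M  ≡ (X ++ tgt e ++ Y) ++ src f ++ Z)
      (q₂ : B  ≡ (X ++ tgt e ++ Y) ++ tgt f ++ Z)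
      (p₃ : A  ≡ (X ++ src e ++ Y) ++ src f ++ Z)
      (q₃ : M' ≡ (X ++ src e ++ Y) ++ tgt f ++ Z)
      (p₄ : M' ≡ X ++ src e ++ (Y ++ tgt f ++ Z))
      (q₄ : B  ≡ X ++ tgt e ++ (Y ++ tgt f ++ Z)) →
      (gen X (Y ++ src f ++ Z) e p₁ q₁ ⨾ gen (X ++ tgt e ++ Y) Z f p₂ q₂)
        ≈ (gen (X ++ src e ++ Y) Z f p₃ q₃ ⨾ gen X (Y ++ tgt f ++ Z) e p₄ q₄)

  _⋉_ : ∀ {A B} (X : List V) → Tm A B → Tm (X ++ A) (X ++ B)
  X ⋉ idt A = idt (X ++ A)
  X ⋉ gen Y Z e p q =
    gen (X ++ Y) Z e
      (trans (cong (X ++_) p) (sym (++-assoc X Y _)))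
      (trans (cong (X ++_) q) (sym (++-assoc X Y _)))
  X ⋉ (f ⨾ g) = (X ⋉ f) ⨾ (X ⋉ g)

  _⋊_ : ∀ {A B} → Tm A B → (W : List V) → Tm (A ++ W) (B ++ W)
  idt A ⋊ W = idt (A ++ W)
  gen X Z e p q ⋊ W =
    gen X (Z ++ W) e
      (trans (cong (_++ W) p)
        (trans (++-assoc X (src e ++ Z) W) (cong (X ++_) (++-assoc (src e) Z W))))
      (trans (cong (_++ W) q)
        (trans (++-assoc X (tgt e ++ Z) W) (cong (X ++_) (++-assoc (tgt e) Z W))))
  (f ⨾ g) ⋊ W = (f ⋊ W) ⨾ (g ⋊ W)

  _∥_ : ∀ {A B A' B'} → Tm A B → Tm A' B' → Set
  _∥_ {A} {B} {A'} {B'} f g = ((f ⋊ A') ⨾ (B ⋉ g)) ≈ ((A ⋉ g) ⨾ (f ⋊ B'))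

  devF : ∀ {A B} → Tm A B → Pred Dev 0ℓ
  devF (idt A)         = ∅
  devF (gen X Y e p q) = dev e
  devF (f ⨾ g)         = devF f ∪ devF g

{-# OPTIONS --safe #-}
-- Parallelism f ∥ g is preserved by composing in either argument and
-- holds trivially against identities, so by induction on both terms it
-- reduces to a pair of generators on disjoint devices, where it is one
-- instance of the interchange law (after reassociating the whiskers).
module Submission where

open import Defs
open import Level using (Level)
open import Data.List using (List; _++_)
open import Data.List.Properties using (++-assoc)
open import Data.Product using (_×_; _,_)
open import Data.Sum using (inj₁; inj₂)
open import Relation.Unary using (Pred; Empty; _∩_; _∪_)
open import Relation.Binary.Bundles using (Setoid)
open import Relation.Binary.Structures using (IsEquivalence)
import Relation.Binary.Reasoning.Setoid as SetoidReasoning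
open import Relation.Binary.PropositionalEquality
  using (_≡_; refl; sym; subst; subst₂)

private variable
  a ℓ₁ ℓ₂ ℓ₃ : Level
  A : Set a
  P : Pred A ℓ₁
  Q : Pred A ℓ₂
  R : Pred A ℓ₃

∩-empty-sym : Empty (P ∩ Q) → Empty (Q ∩ P)
∩-empty-sym P∩Q x (q , p) = P∩Q x (p , q)

∪-∩-empty : Empty ((P ∪ Q) ∩ R) → Empty (P ∩ R) × Empty (Q ∩ R)
∪-∩-empty empty = (λ x (p , r) → empty x (inj₁ p , r))
                , (λ x (q , r) → empty x (inj₂ q , r))

∩-∪-empty : Empty (P ∩ (Q ∪ R)) → Empty (P ∩ Q) × Empty (P ∩ R)
∩-∪-empty empty = (λ x (p , q) → empty x (p , inj₁ q))
                , (λ x (p , r) → empty x (p , inj₂ r))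

++-assoc-middle : (xs ys zs ws : List A) →
                  (xs ++ ys ++ zs) ++ ws ≡ xs ++ ys ++ (zs ++ ws)
++-assoc-middle xs ys zs ws =
  subst (λ l → (xs ++ ys ++ zs) ++ ws ≡ xs ++ l) (++-assoc ys zs ws)
        (++-assoc xs (ys ++ zs) ws)

module Parallel (G : DeviceGraph) where
  open DeviceGraph G
  open Free G

  ≈-isEquivalence : ∀ {A B} → IsEquivalence (_≈_ {A} {B})
  ≈-isEquivalence = record { refl = ≈-refl ; sym = ≈-sym ; trans = ≈-trans }

  ≈-setoid : List V → List V → Setoid _ _
  ≈-setoid A B = record { isEquivalence = ≈-isEquivalence {A} {B} }

  gen-cong : ∀ {A B X X' Y Y'} (e : E)
             (p : A ≡ X ++ src e ++ Y) (q : B ≡ X ++ tgt e ++ Y) →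
             (X≡X' : X ≡ X') (Y≡Y' : Y ≡ Y') →
             gen X Y e p q ≈
             gen X' Y' e (subst₂ (λ X Y → A ≡ X ++ src e ++ Y) X≡X' Y≡Y' p)
                         (subst₂ (λ X Y → B ≡ X ++ tgt e ++ Y) X≡X' Y≡Y' q)
  gen-cong e p q refl refl = ≈-refl

  idt-∥ : ∀ {A A' B'} (g : Tm A' B') → idt A ∥ g
  idt-∥ g = ≈-trans (idˡ _) (≈-sym (idʳ _))

  ∥-idt : ∀ {A B A'} (f : Tm A B) → f ∥ idt A'
  ∥-idt f = ≈-trans (idʳ _) (≈-sym (idˡ _))

  ⨾-∥ : ∀ {A B C A' B'} {f₁ : Tm A B} {f₂ : Tm B C} {g : Tm A' B'} →
        f₁ ∥ g → f₂ ∥ g → (f₁ ⨾ f₂) ∥ g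
  ⨾-∥ {A} {B} {C} {A'} {B'} {f₁} {f₂} {g} f₁∥g f₂∥g = begin
    ((f₁ ⋊ A') ⨾ (f₂ ⋊ A')) ⨾ (C ⋉ g)  ≈⟨ assoc _ _ _ ⟩
    (f₁ ⋊ A') ⨾ ((f₂ ⋊ A') ⨾ (C ⋉ g))  ≈⟨ ⨾-cong ≈-refl f₂∥g ⟩
    (f₁ ⋊ A') ⨾ ((B ⋉ g) ⨾ (f₂ ⋊ B'))  ≈⟨ assoc _ _ _ ⟨
    ((f₁ ⋊ A') ⨾ (B ⋉ g)) ⨾ (f₂ ⋊ B')  ≈⟨ ⨾-cong f₁∥g ≈-refl ⟩
    ((A ⋉ g) ⨾ (f₁ ⋊ B')) ⨾ (f₂ ⋊ B')  ≈⟨ assoc _ _ _ ⟩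
    (A ⋉ g) ⨾ ((f₁ ⋊ B') ⨾ (f₂ ⋊ B'))  ∎
    where open SetoidReasoning (≈-setoid (A ++ A') (C ++ B'))

  ∥-⨾ : ∀ {A B A' B' C'} {f : Tm A B} {g₁ : Tm A' B'} {g₂ : Tm B' C'} →
        f ∥ g₁ → f ∥ g₂ → f ∥ (g₁ ⨾ g₂)
  ∥-⨾ {A} {B} {A'} {B'} {C'} {f} {g₁} {g₂} f∥g₁ f∥g₂ = begin
    (f ⋊ A') ⨾ ((B ⋉ g₁) ⨾ (B ⋉ g₂))  ≈⟨ assoc _ _ _ ⟨
    ((f ⋊ A') ⨾ (B ⋉ g₁)) ⨾ (B ⋉ g₂)  ≈⟨ ⨾-cong f∥g₁ ≈-refl ⟩
    ((A ⋉ g₁) ⨾ (f ⋊ B')) ⨾ (B ⋉ g₂)  ≈⟨ assoc _ _ _ ⟩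
    (A ⋉ g₁) ⨾ ((f ⋊ B') ⨾ (B ⋉ g₂))  ≈⟨ ⨾-cong ≈-refl f∥g₂ ⟩
    (A ⋉ g₁) ⨾ ((A ⋉ g₂) ⨾ (f ⋊ C'))  ≈⟨ assoc _ _ _ ⟨
    ((A ⋉ g₁) ⨾ (A ⋉ g₂)) ⨾ (f ⋊ C')  ∎
    where open SetoidReasoning (≈-setoid (A ++ A') (B ++ C'))

  gen-∥-gen : ∀ X Y X' Y' (e e' : E) → Orthogonal e e' →
              gen X Y e refl refl ∥ gen X' Y' e' refl refl
  -- Interchange is instantiated with middle whisker Y ++ X'; gen-cong regroups
  -- the whiskers produced by ⋊ and ⋉ into that shape on both sides.
  gen-∥-gen X Y X' Y' e e' e⊥e' =
    ≈-trans (⨾-cong (gen-cong e _ _ refl (sym (++-assoc Y X' _)))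
                    (gen-cong e' _ _ (++-assoc-middle X (tgt e) Y X') refl))
   (≈-trans (interchange e e' e⊥e' X (Y ++ X') Y' _ _ _ _ _ _ _ _)
            (⨾-cong (≈-sym (gen-cong e' _ _ (++-assoc-middle X (src e) Y X') refl))
                    (≈-sym (gen-cong e _ _ refl (sym (++-assoc Y X' _))))))

  gen-∥ : ∀ {A B A' B'} X Y (e : E) (p : A ≡ X ++ src e ++ Y) (q : B ≡ X ++ tgt e ++ Y)
          (g : Tm A' B') → Empty (dev e ∩ devF g) → gen X Y e p q ∥ g
  gen-∥ X Y e refl refl (idt _)                  _   = ∥-idt (gen X Y e refl refl)
  gen-∥ X Y e refl refl (gen X' Y' e' refl refl) e⊥g = gen-∥-gen X Y X' Y' e e' e⊥g
  gen-∥ X Y e refl refl (g₁ ⨾ g₂)                e⊥g =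
    let e⊥g₁ , e⊥g₂ = ∩-∪-empty {Q = devF g₁} {R = devF g₂} e⊥g
    in ∥-⨾ {f = gen X Y e refl refl} (gen-∥ X Y e refl refl g₁ e⊥g₁)
                                     (gen-∥ X Y e refl refl g₂ e⊥g₂)

  disjoint⇒∥ : ∀ {A B A' B'} (f : Tm A B) (g : Tm A' B') →
               Empty (devF f ∩ devF g) → f ∥ g
  disjoint⇒∥ (idt _)         g _   = idt-∥ g
  disjoint⇒∥ (gen X Y e p q) g f⊥g = gen-∥ X Y e p q g f⊥g
  disjoint⇒∥ (f₁ ⨾ f₂)       g f⊥g =
    let f₁⊥g , f₂⊥g = ∪-∩-empty {P = devF f₁} {Q = devF f₂} f⊥g
    in ⨾-∥ (disjoint⇒∥ f₁ g f₁⊥g) (disjoint⇒∥ f₂ g f₂⊥g)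

lemma3p20 : (G : DeviceGraph) →
    ∀ {A B A' B' : List (DeviceGraph.V G)}
      (f : Free.Tm G A B) (g : Free.Tm G A' B') →
    Empty (Free.devF G f ∩ Free.devF G g) →
    Free._∥_ G f g × Free._∥_ G g f
lemma3p20 G f g f⊥g =
  disjoint⇒∥ f g f⊥g , disjoint⇒∥ g f (∩-empty-sym {P = devF f} f⊥g)
  where open Parallel G
        open Free G using (devF)
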